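{- Let $G$ be a finite connected simple graph with $n$ vertices and $m$ edges, and let $k\ge 1$ be an integer. Then \[M_2(R_k(G))=2k(k+1)M_1(G)+(k+1)^2M_2(G).\]
   Context: For a graph $H$ and vertex $v$, $d_H(v)$ denotes the degree of $v$ in $H$. Define $M_1(H)=\sum_{v\in V(H)} d_H(v)^2$ and $M_2(H)=\sum_{uv\in E(H)} d_H(u)d_H(v)$. The $k$-th semi total point graph $R_k(G)$ is obtained from $G$ by adding, for each edge $uv$ of $G$, $k$ new vertices (distinct for distinct edges) and joining each of them to both $u$ and $v$ (the edges of $G$ are kept). -}

module Defs where

open import Data.Nat.Base using (ℕ; zero; suc; _+_; _*_; _<ᵇ_)
open import Data.Bool.Base using (Bool; true; false; if_then_else_; _∧_; _∨_)
open import Data.Fin.Base using (Fin; toℕ; splitAt; remQuot)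
open import Data.Fin.Properties using () renaming (_≟_ to _≟ᶠ_)
open import Data.Nat.ListAction using (sum)
open import Data.List.Base using (List; []; _∷_; map; allFin; concatMap; length; lookup)
open import Data.Product.Base using (_×_; _,_; proj₁; proj₂)
open import Data.Sum.Base using (inj₁; inj₂)
open import Relation.Nullary.Decidable.Core using (⌊_⌋)
open import Relation.Binary.PropositionalEquality using (_≡_)

Adj : ℕ → Set
Adj N = Fin N → Fin N → Bool

record SimpleGraph : Set where
  field
    n       : ℕ
    adj     : Adj n
    sym     : ∀ i j → adj i j ≡ adj j i
    irrefl  : ∀ i → adj i i ≡ false
open SimpleGraph public

data Walk {N : ℕ} (A : Adj N) : Fin N → Fin N → Set where
  here  : ∀ {i} → Walk A i i
  step  : ∀ {i j l} → A i j ≡ true → Walk A j l → Walk A i l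

Connected : SimpleGraph → Set
Connected G = ∀ i j → Walk (adj G) i j

deg : ∀ {N} → Adj N → Fin N → ℕ
deg {N} A i = sum (map (λ j → if A i j then 1 else 0) (allFin N))

M₁ : ∀ {N} → Adj N → ℕ
M₁ {N} A = sum (map (λ i → deg A i * deg A i) (allFin N))

-- sum over edges uv (each unordered edge counted once, via toℕ u < toℕ v)
M₂ : ∀ {N} → Adj N → ℕ
M₂ {N} A = sum (map (λ i → sum (map (λ j →
  if (toℕ i <ᵇ toℕ j) ∧ A i j then deg A i * deg A j else 0) (allFin N))) (allFin N))

edges : (G : SimpleGraph) → List (Fin (n G) × Fin (n G))
edges G = concatMap (λ i → concatMap (λ j →
  if (toℕ i <ᵇ toℕ j) ∧ adj G i j then (i , j) ∷ [] else []) (allFin (n G))) (allFin (n G))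

#edges : SimpleGraph → ℕ
#edges G = length (edges G)

-- vertex count of R_k(G): the n old vertices, then m * k new ones;
-- new vertex (e , t) (via remQuot) is the t-th new vertex of edge e.
Rk-size : ℕ → SimpleGraph → ℕ
Rk-size k G = n G + #edges G * k

endpoint : (G : SimpleGraph) → Fin (#edges G) → Fin (n G) → Bool
endpoint G e u = ⌊ u ≟ᶠ proj₁ (lookup (edges G) e) ⌋ ∨ ⌊ u ≟ᶠ proj₂ (lookup (edges G) e) ⌋

-- adjacency of the k-th semi total point graph R_k(G)
Rk : (k : ℕ) → (G : SimpleGraph) → Adj (Rk-size k G)
Rk k G x y with splitAt (n G) x | splitAt (n G) y
... | inj₁ u | inj₁ v = adj G u v
... | inj₁ u | inj₂ b = endpoint G (proj₁ (remQuot k b)) u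
... | inj₂ a | inj₁ v = endpoint G (proj₁ (remQuot k a)) v
... | inj₂ a | inj₂ b = false

-- The degrees of R_k(G) are explicit: an old vertex u gains one new neighbour for each of
-- the k copies of each edge at u, so its degree becomes (k + 1) d(u), and every new vertex
-- has degree 2. Edges of G become edges of R_k(G) of weight (k + 1)² d(u) d(v), giving
-- (k + 1)² M₂(G); each old vertex u lies on k d(u) new edges of weight 2 (k + 1) d(u),
-- giving 2 k (k + 1) M₁(G). The only counting needed is that u is an endpoint of exactly
-- d(u) edges of G.
module Submission where

open import Defs
open import Data.Nat.Base using (ℕ; _+_; _*_; _≤_)
open import Relation.Binary.PropositionalEquality using (_≡_)

open import Data.Nat.Base using (zero; suc; _<_; _<ᵇ_; z≤n; s≤s)
open import Data.Nat.Properties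
  using (+-*-semiring; +-identityʳ; +-assoc; *-comm; *-zeroʳ; *-distribʳ-+; <-cmp; <-irrefl;
         <⇒≤; <-≤-trans; m≤m+n; <ᵇ⇒<; <⇒<ᵇ)
open import Data.Nat.Tactic.RingSolver using (solve-∀)
open import Data.Nat.ListAction using (sum)
open import Data.Nat.ListAction.Properties using (sum-++)
open import Algebra.Properties.Semiring.Sum +-*-semiring
  using (sum-syntax; sum-cong-≗; sum-replicate-zero; ∑-distrib-+; ∑-comm; *-distribˡ-sum; *-distribʳ-sum)
open import Data.Bool.Base using (Bool; true; false; if_then_else_; _∧_; _∨_)
open import Data.Bool.Properties using (∧-zeroʳ; T-≡)
open import Data.Fin.Base using (Fin; zero; suc; toℕ; remQuot; combine; _↑ˡ_; _↑ʳ_)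
open import Data.Fin.Properties
  using (_≟_; toℕ-injective; toℕ<n; toℕ-↑ˡ; toℕ-↑ʳ; splitAt-↑ˡ; splitAt-↑ʳ; remQuot-combine)
open import Data.List.Base using (List; []; _∷_; map; allFin; concatMap; length; lookup; tabulate; _++_)
open import Data.List.Properties using (map-tabulate; map-++)
open import Data.List.Relation.Unary.All as All using (All; []; _∷_)
open import Data.List.Relation.Unary.All.Properties using (concat⁺; map⁺)
open import Data.List.Membership.Propositional.Properties using (∈-lookup)
open import Data.Product.Base using (_×_; _,_; proj₁; proj₂)
open import Relation.Binary.Definitions using (tri<; tri≈; tri>)
open import Relation.Binary.PropositionalEquality using (refl; trans; cong; cong₂; _≢_)
import Relation.Binary.PropositionalEquality as ≡
open import Relation.Nullary.Decidable using (⌊_⌋; yes; no; ⌊⌋-map′)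
open import Relation.Nullary.Negation using (contradiction)
open import Function.Base using (id; _∘_)
open import Function.Bundles using (Equivalence)
open Relation.Binary.PropositionalEquality.≡-Reasoning

-- Iverson bracket, written as in the summand of deg so that deg A u is definitionally a sum of brackets.
[_] : Bool → ℕ
[ b ] = if b then 1 else 0

<⇒<ᵇ≡true : ∀ {m n} → m < n → (m <ᵇ n) ≡ true
<⇒<ᵇ≡true m<n = Equivalence.to T-≡ (<⇒<ᵇ m<n)

≤⇒<ᵇ≡false : ∀ {m n} → n ≤ m → (m <ᵇ n) ≡ false
≤⇒<ᵇ≡false z≤n       = refl
≤⇒<ᵇ≡false (s≤s n≤m) = ≤⇒<ᵇ≡false n≤m

All-concatMap : ∀ {A B : Set} {P : B → Set} {f : A → List B} →
                (∀ x → All P (f x)) → ∀ xs → All P (concatMap f xs)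
All-concatMap all-f xs = concat⁺ (map⁺ (All.universal all-f xs))

sum-tabulate : ∀ {n} (f : Fin n → ℕ) → sum (tabulate f) ≡ ∑[ i < n ] f i
sum-tabulate {zero}  f = refl
sum-tabulate {suc n} f = cong (f zero +_) (sum-tabulate (f ∘ suc))

sum-map-allFin : ∀ {n} (f : Fin n → ℕ) → sum (map f (allFin n)) ≡ ∑[ i < n ] f i
sum-map-allFin f = trans (cong sum (map-tabulate id f)) (sum-tabulate f)

∑-lookup : ∀ {A : Set} (h : A → ℕ) (xs : List A) →
           ∑[ i < length xs ] h (lookup xs i) ≡ sum (map h xs)
∑-lookup h []       = refl
∑-lookup h (x ∷ xs) = cong (h x +_) (∑-lookup h xs)

sum-map-concatMap : ∀ {A B : Set} (h : B → ℕ) (f : A → List B) (xs : List A) →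
                    sum (map h (concatMap f xs)) ≡ sum (map (λ x → sum (map h (f x))) xs)
sum-map-concatMap h f []       = refl
sum-map-concatMap h f (x ∷ xs) = begin
  sum (map h (f x ++ concatMap f xs))               ≡⟨ cong sum (map-++ h (f x) (concatMap f xs)) ⟩
  sum (map h (f x) ++ map h (concatMap f xs))       ≡⟨ sum-++ (map h (f x)) _ ⟩
  sum (map h (f x)) + sum (map h (concatMap f xs))  ≡⟨ cong (sum (map h (f x)) +_) (sum-map-concatMap h f xs) ⟩
  sum (map h (f x)) + sum (map (λ y → sum (map h (f y))) xs) ∎

∑-↑ : ∀ m {n} (f : Fin (m + n) → ℕ) →
      ∑[ x < m + n ] f x ≡ ∑[ i < m ] f (i ↑ˡ n) + ∑[ j < n ] f (m ↑ʳ j)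
∑-↑ zero    f = refl
∑-↑ (suc m) f = trans (cong (f zero +_) (∑-↑ m (f ∘ suc))) (≡.sym (+-assoc (f zero) _ _))

∑-combine : ∀ m {n} (f : Fin (m * n) → ℕ) →
            ∑[ x < m * n ] f x ≡ ∑[ i < m ] ∑[ j < n ] f (combine i j)
∑-combine zero    f = refl
∑-combine (suc m) {n} f =
  trans (∑-↑ n f) (cong (∑[ j < n ] f (j ↑ˡ (m * n)) +_) (∑-combine m (λ x → f (n ↑ʳ x))))

∑-const : ∀ n c → ∑[ i < n ] c ≡ n * c
∑-const zero    c = refl
∑-const (suc n) c = cong (c +_) (∑-const n c)

∑-[≟]* : ∀ {n} (a : Fin n) (f : Fin n → ℕ) → ∑[ v < n ] ([ ⌊ a ≟ v ⌋ ] * f v) ≡ f a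
∑-[≟]* {suc n} zero    f = trans (cong₂ _+_ (+-identityʳ (f zero)) (sum-replicate-zero n)) (+-identityʳ (f zero))
∑-[≟]* {suc n} (suc a) f =
  trans (sum-cong-≗ (λ v → cong (λ b → [ b ] * f (suc v)) (⌊⌋-map′ _ _ (a ≟ v)))) (∑-[≟]* a (f ∘ suc))

∑-[≟] : ∀ {n} (a : Fin n) → ∑[ v < n ] [ ⌊ v ≟ a ⌋ ] ≡ 1
∑-[≟] {suc n} zero    = cong suc (sum-replicate-zero n)
∑-[≟] {suc n} (suc a) = trans (sum-cong-≗ (λ v → cong [_] (⌊⌋-map′ _ _ (v ≟ a)))) (∑-[≟] a)

[≟∨≟] : ∀ {n} {a b : Fin n} → a ≢ b → ∀ u → [ ⌊ u ≟ a ⌋ ∨ ⌊ u ≟ b ⌋ ] ≡ [ ⌊ u ≟ a ⌋ ] + [ ⌊ u ≟ b ⌋ ]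
[≟∨≟] {a = a} {b} a≢b u with u ≟ a | u ≟ b
... | yes refl | yes refl = contradiction refl a≢b
... | yes _    | no _     = refl
... | no _     | yes _    = refl
... | no _     | no _     = refl

M₂-summand : ∀ {N} → Adj N → Fin N → Fin N → ℕ
M₂-summand A i j = if (toℕ i <ᵇ toℕ j) ∧ A i j then deg A i * deg A j else 0

M₂≡∑∑ : ∀ {N} (A : Adj N) → M₂ A ≡ ∑[ i < N ] ∑[ j < N ] M₂-summand A i j
M₂≡∑∑ A = trans (sum-map-allFin (λ i → sum (map (M₂-summand A i) (allFin _))))
                 (sum-cong-≗ (λ i → sum-map-allFin (M₂-summand A i)))

M₁≡∑ : ∀ {N} (A : Adj N) → M₁ A ≡ ∑[ i < N ] (deg A i * deg A i)
M₁≡∑ A = sum-map-allFin (λ i → deg A i * deg A i)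

deg≡∑ : ∀ {N} (A : Adj N) u → deg A u ≡ ∑[ v < N ] [ A u v ]
deg≡∑ A u = sum-map-allFin (λ v → [ A u v ])

module EdgeList (G : SimpleGraph) where

  private
    N = n G
    A = adj G

  adj< : Fin N → Fin N → Bool
  adj< i j = (toℕ i <ᵇ toℕ j) ∧ A i j

  listed : Fin N → Fin N → List (Fin N × Fin N)
  listed i j = if adj< i j then (i , j) ∷ [] else []

  adj<-irrefl : ∀ i → adj< i i ≡ false
  adj<-irrefl i = trans (cong ((toℕ i <ᵇ toℕ i) ∧_) (irrefl G i)) (∧-zeroʳ _)

  [adj<]+[adj>]≡[adj] : ∀ u v → [ adj< u v ] + [ adj< v u ] ≡ [ A u v ]
  [adj<]+[adj>]≡[adj] u v with <-cmp (toℕ u) (toℕ v)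
  ... | tri< u<v _ _ rewrite <⇒<ᵇ≡true u<v | ≤⇒<ᵇ≡false (<⇒≤ u<v) = +-identityʳ _
  ... | tri≈ _ u≡v _ rewrite toℕ-injective u≡v | adj<-irrefl v | irrefl G v = refl
  ... | tri> _ _ v<u rewrite <⇒<ᵇ≡true v<u | ≤⇒<ᵇ≡false (<⇒≤ v<u) | SimpleGraph.sym G v u = refl

  edges-ordered : All (λ e → toℕ (proj₁ e) < toℕ (proj₂ e)) (edges G)
  edges-ordered = All-concatMap (λ i → All-concatMap (listed-ordered i) (allFin N)) (allFin N)
    where
    listed-ordered : ∀ i j → All (λ e → toℕ (proj₁ e) < toℕ (proj₂ e)) (listed i j)
    listed-ordered i j with toℕ i <ᵇ toℕ j in i<ᵇj | A i j
    ... | true  | true  = <ᵇ⇒< (toℕ i) (toℕ j) (Equivalence.from T-≡ i<ᵇj) ∷ []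
    ... | true  | false = []
    ... | false | _     = []

  source : Fin (#edges G) → Fin N
  source e = proj₁ (lookup (edges G) e)

  target : Fin (#edges G) → Fin N
  target e = proj₂ (lookup (edges G) e)

  source≢target : ∀ e → source e ≢ target e
  source≢target e s≡t = <-irrefl (cong toℕ s≡t) (All.lookup edges-ordered (∈-lookup {xs = edges G} e))

  [endpoint] : ∀ e u → [ endpoint G e u ] ≡ [ ⌊ u ≟ source e ⌋ ] + [ ⌊ u ≟ target e ⌋ ]
  [endpoint] e = [≟∨≟] (source≢target e)

  endpoint-count : ∀ e → ∑[ v < N ] [ endpoint G e v ] ≡ 2
  endpoint-count e = begin
    ∑[ v < N ] [ endpoint G e v ]                                     ≡⟨ sum-cong-≗ ([endpoint] e) ⟩
    ∑[ v < N ] ([ ⌊ v ≟ source e ⌋ ] + [ ⌊ v ≟ target e ⌋ ])          ≡⟨ ∑-distrib-+ {N} _ _ ⟩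
    ∑[ v < N ] [ ⌊ v ≟ source e ⌋ ] + ∑[ v < N ] [ ⌊ v ≟ target e ⌋ ] ≡⟨ cong₂ _+_ (∑-[≟] (source e)) (∑-[≟] (target e)) ⟩
    2 ∎

  sum-map-edges : (h : Fin N × Fin N → ℕ) →
                  sum (map h (edges G)) ≡ ∑[ i < N ] ∑[ j < N ] ([ adj< i j ] * h (i , j))
  sum-map-edges h = begin
    sum (map h (edges G))
      ≡⟨ sum-map-concatMap h _ (allFin N) ⟩
    sum (map (λ i → sum (map h (concatMap (listed i) (allFin N)))) (allFin N))
      ≡⟨ sum-map-allFin {N} _ ⟩
    ∑[ i < N ] sum (map h (concatMap (listed i) (allFin N)))
      ≡⟨ sum-cong-≗ (λ i → trans (sum-map-concatMap h (listed i) (allFin N)) (sum-map-allFin {N} _)) ⟩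
    ∑[ i < N ] ∑[ j < N ] sum (map h (listed i j))
      ≡⟨ sum-cong-≗ (λ i → sum-cong-≗ (λ j → sum-singleton-if (adj< i j))) ⟩
    ∑[ i < N ] ∑[ j < N ] ([ adj< i j ] * h (i , j)) ∎
    where
    sum-singleton-if : ∀ {e} b → sum (map h (if b then e ∷ [] else [])) ≡ [ b ] * h e
    sum-singleton-if true  = refl
    sum-singleton-if false = refl

  incident-edges : ∀ u → ∑[ e < #edges G ] [ endpoint G e u ] ≡ deg A u
  incident-edges u = begin
    ∑[ e < #edges G ] [ endpoint G e u ]
      ≡⟨ sum-cong-≗ (λ e → [endpoint] e u) ⟩
    ∑[ e < #edges G ] ([ ⌊ u ≟ source e ⌋ ] + [ ⌊ u ≟ target e ⌋ ])
      ≡⟨ ∑-lookup (λ e → [ ⌊ u ≟ proj₁ e ⌋ ] + [ ⌊ u ≟ proj₂ e ⌋ ]) (edges G) ⟩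
    sum (map (λ e → [ ⌊ u ≟ proj₁ e ⌋ ] + [ ⌊ u ≟ proj₂ e ⌋ ]) (edges G))
      ≡⟨ sum-map-edges _ ⟩
    ∑[ i < N ] ∑[ j < N ] ([ adj< i j ] * ([ ⌊ u ≟ i ⌋ ] + [ ⌊ u ≟ j ⌋ ]))
      ≡⟨ sum-cong-≗ {N} (λ i → trans (sum-cong-≗ {N} (λ j → trans (*-comm [ adj< i j ] _) (*-distribʳ-+ [ adj< i j ] [ ⌊ u ≟ i ⌋ ] [ ⌊ u ≟ j ⌋ ])))
                                 (∑-distrib-+ {N} _ _)) ⟩
    ∑[ i < N ] (∑[ j < N ] ([ ⌊ u ≟ i ⌋ ] * [ adj< i j ]) + ∑[ j < N ] ([ ⌊ u ≟ j ⌋ ] * [ adj< i j ]))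
      ≡⟨ ∑-distrib-+ {N} _ _ ⟩
    ∑[ i < N ] ∑[ j < N ] ([ ⌊ u ≟ i ⌋ ] * [ adj< i j ]) + ∑[ i < N ] ∑[ j < N ] ([ ⌊ u ≟ j ⌋ ] * [ adj< i j ])
      ≡⟨ cong₂ _+_ out-edges in-edges ⟩
    ∑[ v < N ] [ adj< u v ] + ∑[ v < N ] [ adj< v u ]
      ≡⟨ ≡.sym (∑-distrib-+ {N} _ _) ⟩
    ∑[ v < N ] ([ adj< u v ] + [ adj< v u ])
      ≡⟨ sum-cong-≗ ([adj<]+[adj>]≡[adj] u) ⟩
    ∑[ v < N ] [ A u v ]
      ≡⟨ ≡.sym (deg≡∑ A u) ⟩
    deg A u ∎
    where
    out-edges : ∑[ i < N ] ∑[ j < N ] ([ ⌊ u ≟ i ⌋ ] * [ adj< i j ]) ≡ ∑[ v < N ] [ adj< u v ]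
    out-edges = trans (sum-cong-≗ (λ i → ≡.sym (*-distribˡ-sum {N} [ ⌊ u ≟ i ⌋ ] _)))
                      (∑-[≟]* u (λ i → ∑[ j < N ] [ adj< i j ]))

    in-edges : ∑[ i < N ] ∑[ j < N ] ([ ⌊ u ≟ j ⌋ ] * [ adj< i j ]) ≡ ∑[ v < N ] [ adj< v u ]
    in-edges = trans (∑-comm {N} {N} _)
                 (trans (sum-cong-≗ (λ j → ≡.sym (*-distribˡ-sum {N} [ ⌊ u ≟ j ⌋ ] _)))
                        (∑-[≟]* u (λ j → ∑[ i < N ] [ adj< i j ])))

module SemiTotalPointGraph (k : ℕ) (G : SimpleGraph) where

  open EdgeList G using (incident-edges; endpoint-count)

  N : ℕ
  N = n G

  A : Adj N
  A = adj G

  p : ℕ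
  p = #edges G * k

  R : Adj (N + p)
  R = Rk k G

  old : Fin N → Fin (N + p)
  old u = u ↑ˡ p

  new : Fin p → Fin (N + p)
  new b = N ↑ʳ b

  edgeOf : Fin p → Fin (#edges G)
  edgeOf b = proj₁ (remQuot k b)

  R-old-old : ∀ u v → R (old u) (old v) ≡ A u v
  R-old-old u v rewrite splitAt-↑ˡ N u p | splitAt-↑ˡ N v p = refl

  R-old-new : ∀ u b → R (old u) (new b) ≡ endpoint G (edgeOf b) u
  R-old-new u b rewrite splitAt-↑ˡ N u p | splitAt-↑ʳ N p b = refl

  R-new-old : ∀ a v → R (new a) (old v) ≡ endpoint G (edgeOf a) v
  R-new-old a v rewrite splitAt-↑ʳ N p a | splitAt-↑ˡ N v p = refl

  R-new-new : ∀ a b → R (new a) (new b) ≡ false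
  R-new-new a b rewrite splitAt-↑ʳ N p a | splitAt-↑ʳ N p b = refl

  old<new : ∀ u b → toℕ (old u) < toℕ (new b)
  old<new u b rewrite toℕ-↑ˡ u p | toℕ-↑ʳ N b = <-≤-trans (toℕ<n u) (m≤m+n N (toℕ b))

  new-neighbours : ∀ u → ∑[ b < p ] [ endpoint G (edgeOf b) u ] ≡ k * deg A u
  new-neighbours u = begin
    ∑[ b < p ] [ endpoint G (edgeOf b) u ]
      ≡⟨ ∑-combine (#edges G) _ ⟩
    ∑[ e < #edges G ] ∑[ t < k ] [ endpoint G (edgeOf (combine e t)) u ]
      ≡⟨ sum-cong-≗ {#edges G} (λ e → trans (sum-cong-≗ {k} (λ t → cong (λ et → [ endpoint G (proj₁ et) u ]) (remQuot-combine e t)))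
                                 (∑-const k [ endpoint G e u ])) ⟩
    ∑[ e < #edges G ] (k * [ endpoint G e u ])
      ≡⟨ ≡.sym (*-distribˡ-sum {#edges G} k _) ⟩
    k * ∑[ e < #edges G ] [ endpoint G e u ]
      ≡⟨ cong (k *_) (incident-edges u) ⟩
    k * deg A u ∎

  deg-old : ∀ u → deg R (old u) ≡ suc k * deg A u
  deg-old u = begin
    deg R (old u)
      ≡⟨ trans (deg≡∑ R (old u)) (∑-↑ N _) ⟩
    ∑[ v < N ] [ R (old u) (old v) ] + ∑[ b < p ] [ R (old u) (new b) ]
      ≡⟨ cong₂ _+_ (sum-cong-≗ (cong [_] ∘ R-old-old u)) (sum-cong-≗ (cong [_] ∘ R-old-new u)) ⟩
    ∑[ v < N ] [ A u v ] + ∑[ b < p ] [ endpoint G (edgeOf b) u ]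
      ≡⟨ cong₂ _+_ (≡.sym (deg≡∑ A u)) (new-neighbours u) ⟩
    deg A u + k * deg A u ∎

  deg-new : ∀ b → deg R (new b) ≡ 2
  deg-new b = begin
    deg R (new b)
      ≡⟨ trans (deg≡∑ R (new b)) (∑-↑ N _) ⟩
    ∑[ v < N ] [ R (new b) (old v) ] + ∑[ c < p ] [ R (new b) (new c) ]
      ≡⟨ cong₂ _+_ (sum-cong-≗ (cong [_] ∘ R-new-old b))
                   (trans (sum-cong-≗ (cong [_] ∘ R-new-new b)) (sum-replicate-zero p)) ⟩
    ∑[ v < N ] [ endpoint G (edgeOf b) v ] + 0
      ≡⟨ trans (+-identityʳ _) (endpoint-count (edgeOf b)) ⟩
    2 ∎

  term-old-old : ∀ u v → M₂-summand R (old u) (old v) ≡ (suc k * suc k) * M₂-summand A u v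
  term-old-old u v rewrite toℕ-↑ˡ u p | toℕ-↑ˡ v p | R-old-old u v | deg-old u | deg-old v
    with (toℕ u <ᵇ toℕ v) ∧ A u v
  ... | true  = interchange (suc k) (deg A u) (deg A v)
    where
    interchange : ∀ a b c → (a * b) * (a * c) ≡ (a * a) * (b * c)
    interchange = solve-∀
  ... | false = ≡.sym (*-zeroʳ (suc k * suc k))

  term-old-new : ∀ u b → M₂-summand R (old u) (new b) ≡ [ endpoint G (edgeOf b) u ] * (suc k * deg A u * 2)
  term-old-new u b rewrite <⇒<ᵇ≡true (old<new u b) | R-old-new u b | deg-old u | deg-new b
    with endpoint G (edgeOf b) u
  ... | true  = ≡.sym (+-identityʳ _)
  ... | false = refl

  term-new-old : ∀ a v → M₂-summand R (new a) (old v) ≡ 0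
  term-new-old a v rewrite ≤⇒<ᵇ≡false (<⇒≤ (old<new v a)) = refl

  term-new-new : ∀ a b → M₂-summand R (new a) (new b) ≡ 0
  term-new-new a b rewrite R-new-new a b | ∧-zeroʳ (toℕ (new a) <ᵇ toℕ (new b)) = refl

  row-old : ∀ u → ∑[ y < N + p ] M₂-summand R (old u) y
                  ≡ (suc k * suc k) * ∑[ v < N ] M₂-summand A u v + 2 * k * suc k * (deg A u * deg A u)
  row-old u = begin
    ∑[ y < N + p ] M₂-summand R (old u) y
      ≡⟨ ∑-↑ N _ ⟩
    ∑[ v < N ] M₂-summand R (old u) (old v) + ∑[ b < p ] M₂-summand R (old u) (new b)
      ≡⟨ cong₂ _+_ (trans (sum-cong-≗ (term-old-old u)) (≡.sym (*-distribˡ-sum {N} (suc k * suc k) (M₂-summand A u))))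
                   (trans (sum-cong-≗ (term-old-new u)) (≡.sym (*-distribʳ-sum {p} (suc k * deg A u * 2) (λ b → [ endpoint G (edgeOf b) u ])))) ⟩
    (suc k * suc k) * ∑[ v < N ] M₂-summand A u v + ∑[ b < p ] [ endpoint G (edgeOf b) u ] * (suc k * deg A u * 2)
      ≡⟨ cong (λ x → (suc k * suc k) * ∑[ v < N ] M₂-summand A u v + x * (suc k * deg A u * 2)) (new-neighbours u) ⟩
    (suc k * suc k) * ∑[ v < N ] M₂-summand A u v + k * deg A u * (suc k * deg A u * 2)
      ≡⟨ cong ((suc k * suc k) * ∑[ v < N ] M₂-summand A u v +_) (regroup k (deg A u)) ⟩
    (suc k * suc k) * ∑[ v < N ] M₂-summand A u v + 2 * k * suc k * (deg A u * deg A u) ∎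
    where
    regroup : ∀ k d → k * d * (suc k * d * 2) ≡ 2 * k * suc k * (d * d)
    regroup = solve-∀

  row-new : ∀ a → ∑[ y < N + p ] M₂-summand R (new a) y ≡ 0
  row-new a = begin
    ∑[ y < N + p ] M₂-summand R (new a) y
      ≡⟨ ∑-↑ N _ ⟩
    ∑[ v < N ] M₂-summand R (new a) (old v) + ∑[ b < p ] M₂-summand R (new a) (new b)
      ≡⟨ cong₂ _+_ (trans (sum-cong-≗ (term-new-old a)) (sum-replicate-zero N))
                   (trans (sum-cong-≗ (term-new-new a)) (sum-replicate-zero p)) ⟩
    0 ∎

theorem2p9 : (G : SimpleGraph) → Connected G → (k : ℕ) → 1 ≤ k →
    M₂ (Rk k G) ≡ 2 * k * (k + 1) * M₁ (adj G) + (k + 1) * (k + 1) * M₂ (adj G)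
theorem2p9 G _ k _ = begin
  M₂ R
    ≡⟨ trans (M₂≡∑∑ R) (∑-↑ N _) ⟩
  ∑[ u < N ] ∑[ y < N + p ] M₂-summand R (old u) y + ∑[ a < p ] ∑[ y < N + p ] M₂-summand R (new a) y
    ≡⟨ cong₂ _+_ (trans (sum-cong-≗ row-old) (∑-distrib-+ {N} _ _))
                 (trans (sum-cong-≗ row-new) (sum-replicate-zero p)) ⟩
  ∑[ u < N ] ((suc k * suc k) * ∑[ v < N ] M₂-summand A u v) + ∑[ u < N ] (2 * k * suc k * (deg A u * deg A u)) + 0
    ≡⟨ cong₂ (λ x y → x + y + 0) (≡.sym (*-distribˡ-sum (suc k * suc k) (λ u → ∑[ v < N ] M₂-summand A u v)))
                                 (≡.sym (*-distribˡ-sum (2 * k * suc k) (λ u → deg A u * deg A u))) ⟩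
  (suc k * suc k) * ∑[ u < N ] ∑[ v < N ] M₂-summand A u v + 2 * k * suc k * ∑[ u < N ] (deg A u * deg A u) + 0
    ≡⟨ cong₂ (λ x y → (suc k * suc k) * x + 2 * k * suc k * y + 0) (≡.sym (M₂≡∑∑ A)) (≡.sym (M₁≡∑ A)) ⟩
  (suc k * suc k) * M₂ A + 2 * k * suc k * M₁ A + 0
    ≡⟨ rearrange k (M₂ A) (M₁ A) ⟩
  2 * k * (k + 1) * M₁ A + (k + 1) * (k + 1) * M₂ A ∎
  where
  open SemiTotalPointGraph k G

  rearrange : ∀ k a b → (suc k * suc k) * a + 2 * k * suc k * b + 0 ≡ 2 * k * (k + 1) * b + (k + 1) * (k + 1) * a
  rearrange = solve-∀
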